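{- Let $m\ge 1$. If $\pi\in S_{2m+1}$ is toppleable, then $\pi^{ -1}(1)\le m+1$. Conversely, for $\pi\in S_{2m+1}$ with $n=2m+1$: if $\pi^{ -1}(1)\le m+1$ then $1$ is in the first position of $\mathcal{T}(\pi,m+1)$, and if $\pi^{ -1}(n)\ge m+1$ then $n+1$ is in the last position of $\mathcal{T}(\pi,m+1)$. If $\pi\in S_{2m}$ is toppleable, then $\pi^{ -1}(1)\le m$. Conversely, for $\pi\in S_{2m}$: if $\pi^{ -1}(1)\le m$ then $1$ is in the first position of $\mathcal{T}(\pi,m+1)$, and if $\pi^{ -1}(2m)\ge m$ then $2m+1$ is in the last position of $\mathcal{T}(\pi,m+1)$.
   Context: For an integer $n\ge 2$ let $L_n=\{ -\lfloor (n+1)/2\rfloor,\dots,\lfloor n/2\rfloor+1\}\subset\mathbb{Z}$; position $0$ is the origin. A toppling move chooses a position $i$ holding at least two chips, chooses two chips $\alpha<\beta$ at $i$, and moves $\alpha$ to $i-1$ and $\beta$ to $i+1$; the toppling process applies such moves (arbitrary choices) until no position holds two or more chips. For $\pi\in S_n$ and $r\in[n+1]$, the initial configuration $\pi^{(r)}$ has, for $j=1,\dots,n$, one chip at position $-\lfloor (n-1)/2\rfloor+j-1$ labeled $\pi_j$ if $\pi_j<r$ and $\pi_j+1$ if $\pi_j\ge r$, plus a chip labeled $r$ at the origin. The final configuration does not depend on the choices and has at most one chip per position; reading chips left to right gives $\mathcal{T}(\pi,r)\in S_{n+1}$. $\pi$ is $r$-toppleable if $\mathcal{T}(\pi,r)$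 is the identity, and toppleable if it is $r$-toppleable for all $r\in[n+1]$. The position of value $v$ in $\pi$ is $\pi^{ -1}(v)$. -}

module Defs where

open import Data.Nat as ℕ using (ℕ; zero; suc; _<ᵇ_; _∸_; _/_)
open import Data.Integer as ℤ using (ℤ; +_)
open import Data.Fin using (Fin; toℕ)
open import Data.Fin.Permutation using (Permutation′; _⟨$⟩ʳ_)
open import Data.List using (List; []; _∷_; map; allFin; upTo)
open import Data.List.Relation.Binary.Permutation.Propositional using (_↭_)
open import Data.List.Relation.Unary.Unique.Propositional using (Unique)
open import Data.List.Relation.Unary.Linked using (Linked)
open import Data.Product using (_×_; _,_; ∃; proj₁; proj₂)
open import Data.Bool using (if_then_else_)
open import Relation.Binary.PropositionalEquality using (_≡_)
open import Relation.Binary.Construct.Closure.ReflexiveTransitive using (Star)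

-- A chip: (position, label).  A configuration is a multiset of chips,
-- represented as a list considered up to permutation (_↭_).
Chip : Set
Chip = ℤ × ℕ

Config : Set
Config = List Chip

data Step : Config → Config → Set where
  topple : ∀ {c} (i : ℤ) (α β : ℕ) (rest : Config) →
           α ℕ.< β →
           c ↭ ((i , α) ∷ (i , β) ∷ rest) →
           Step c ((i ℤ.- ℤ.1ℤ , α) ∷ (i ℤ.+ ℤ.1ℤ , β) ∷ rest)

Stable : Config → Set
Stable c = Unique (map proj₁ c)

Reads : Config → List ℕ → Set
Reads c w = ∃ λ s → (c ↭ s) × Linked ℤ._<_ (map proj₁ s) × (map proj₂ s ≡ w)

-- Value of π (a permutation of [n]) at 1-indexed position j+1, as a number in [n].
val : ∀ {n} → Permutation′ n → Fin n → ℕ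
val π j = suc (toℕ (π ⟨$⟩ʳ j))

pos : ∀ {n} → Fin n → ℕ
pos j = suc (toℕ j)

relabel : ℕ → ℕ → ℕ
relabel r v = if v <ᵇ r then v else suc v

initConfig : ∀ {n} → Permutation′ n → ℕ → Config
initConfig {n} π r =
  (+ 0 , r) ∷ map (λ j → ((+ toℕ j) ℤ.- (+ ((n ∸ 1) / 2)) , relabel r (val π j))) (allFin n)

-- T(π, r) = w : the toppling process started at π^{(r)} reaches a final
-- (stable) configuration whose left-to-right reading is w.
Topples : ∀ {n} → Permutation′ n → ℕ → List ℕ → Set
Topples π r w = ∃ λ c → Star Step (initConfig π r) c × Stable c × Reads c w

idWord : ℕ → List ℕ
idWord k = map suc (upTo k)

RToppleable : ∀ {n} → Permutation′ n → ℕ → Set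
RToppleable {n} π r = Topples π r (idWord (suc n))

Toppleable : ∀ {n} → Permutation′ n → Set
Toppleable {n} π = ∀ r → 1 ℕ.≤ r → r ℕ.≤ suc n → RToppleable π r

module Submission where

-- Start from one chip on each site of an interval [a, b] plus a second chip at the origin. Every
-- configuration reached by toppling has at most two chips per site and an empty site between any
-- two doubled sites. Hence the leftmost doubled site only ever moves left, one step at a time,
-- always keeping the smaller of its two chips, until it reaches a; the chip it then drops at a - 1
-- is never moved again and is the first letter of T(π, r). That chip started at or left of the
-- origin and carries the least label found there. So 1 comes first when it starts left of the
-- origin, and a toppleable π cannot have 1 right of it (otherwise T(π, r) starts with a label
-- ≥ 2). Negating sites and reversing labels turns the claim that n + 1 comes last into a claim
-- about the first letter of the mirrored process.

open import Defs

module Toppling where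

  open import Data.Bool using (true; false)
  open import Data.Empty using (⊥; ⊥-elim)
  open import Data.Fin using (Fin; toℕ; fromℕ<)
  import Data.Fin.Properties as Fin
  open import Data.Fin.Permutation using (Permutation′; _⟨$⟩ʳ_; _⟨$⟩ˡ_; inverseˡ; inverseʳ)
  open import Data.Integer as ℤ using (ℤ; +_; 0ℤ; 1ℤ; -_; _+_; _-_; _<_; _≤_)
  import Data.Integer.Properties as ℤP
  open import Data.Integer.Tactic.RingSolver using (solve-∀)
  open import Data.List using ([]; _∷_; map; filter; length; head; last; allFin)
  open import Data.List.Properties using (filter-accept; filter-reject; filter-none; map-∘)
  open import Data.List.Membership.Propositional using (_∈_; _∉_)
  open import Data.List.Membership.Propositional.Properties using (∈-map⁺; ∈-map⁻; ∈-allFin)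
  open import Data.List.Relation.Unary.Any using (here; there)
  import Data.List.Relation.Unary.All as All
  import Data.List.Relation.Unary.All.Properties as All
  open import Data.List.Relation.Unary.AllPairs using (_∷_)
  open import Data.List.Relation.Unary.Linked using (Linked; _∷_)
  open import Data.List.Relation.Unary.Linked.Properties using (Linked⇒AllPairs)
  open import Data.List.Relation.Unary.Unique.Propositional using (Unique; []; _∷_)
  import Data.List.Relation.Unary.Unique.Propositional.Properties as Unique
  open import Data.List.Relation.Binary.Permutation.Propositional using (_↭_; ↭-refl; ↭-sym; ↭-trans; swap)
  open import Data.List.Relation.Binary.Permutation.Propositional.Properties
    using (↭-length; filter-↭; ∈-resp-↭; map⁺)
  open import Data.Maybe using (just)
  open import Data.Maybe.Properties using (just-injective)
  open import Data.Nat as ℕ using (ℕ; suc; _∸_; z≤n; s≤s)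
  import Data.Nat.Properties as ℕP
  open import Data.Nat.DivMod using (_/_; m/n≤m)
  open import Data.Product using (_×_; _,_; ∃-syntax; proj₁; proj₂)
  open import Data.Sum using (_⊎_; inj₁; inj₂)
  open import Data.Unit using (⊤; tt)
  open import Function using (_∘′_)
  open import Relation.Binary.Construct.Closure.ReflexiveTransitive using (Star; ε; _◅_)
  import Relation.Binary.Construct.Closure.ReflexiveTransitive as Star
  open import Relation.Binary.Definitions using (tri<; tri≈; tri>)
  open import Relation.Binary.PropositionalEquality
    using (_≡_; _≢_; refl; sym; trans; cong; subst; subst₂; ≢-sym; module ≡-Reasoning)
  open import Relation.Nullary using (Dec; yes; no; ¬_)

  at? : ∀ p (chip : Chip) → Dec (proj₁ chip ≡ p)
  at? p chip = proj₁ chip ℤ.≟ p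

  occupancy : ℤ → Config → ℕ
  occupancy p c = length (filter (at? p) c)

  occupancy-resp-↭ : ∀ p {c d} → c ↭ d → occupancy p c ≡ occupancy p d
  occupancy-resp-↭ p c↭d = ↭-length (filter-↭ (at? p) c↭d)

  occupancy-here : ∀ p l c → occupancy p ((p , l) ∷ c) ≡ suc (occupancy p c)
  occupancy-here p l c = cong length (filter-accept (at? p) {xs = c} refl)

  occupancy-there : ∀ {p q} l c → q ≢ p → occupancy p ((q , l) ∷ c) ≡ occupancy p c
  occupancy-there {p} l c q≢p = cong length (filter-reject (at? p) {xs = c} q≢p)

  ∈⇒occupied : ∀ {p l c} → (p , l) ∈ c → 0 ℕ.< occupancy p c
  ∈⇒occupied {p} {c = (_ , l) ∷ c} (here refl) =
    subst (0 ℕ.<_) (sym (occupancy-here p l c)) (s≤s z≤n)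
  ∈⇒occupied {p} {c = (q , _) ∷ _} (there m) with q ℤ.≟ p
  ... | yes _ = ℕP.m<n⇒m<1+n (∈⇒occupied m)
  ... | no _ = ∈⇒occupied m

  unoccupied⇒∉ : ∀ {p l c} → occupancy p c ≡ 0 → (p , l) ∉ c
  unoccupied⇒∉ empty m = ℕP.<⇒≢ (∈⇒occupied m) (sym empty)

  Stable⇒occupancy≤1 : ∀ {c} → Stable c → ∀ p → occupancy p c ℕ.≤ 1
  Stable⇒occupancy≤1 {[]} [] p = z≤n
  Stable⇒occupancy≤1 {(q , _) ∷ c} (q∉c ∷ stable) p with q ℤ.≟ p
  ... | yes refl = s≤s (ℕP.≤-reflexive (cong length (filter-none (at? q) {xs = c} elsewhere)))
    where
      elsewhere : All.All (λ chip → ¬ proj₁ chip ≡ q) c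
      elsewhere = All.map⁻ (All.map (λ q≢p p≡q → q≢p (sym p≡q)) q∉c)
  ... | no _ = Stable⇒occupancy≤1 stable p

  >⇒≢ : ∀ {i j} → j < i → i ≢ j
  >⇒≢ j<i = ≢-sym (ℤP.<⇒≢ j<i)

  i-1<i : ∀ i → i - 1ℤ < i
  i-1<i i = ℤP.i≤pred[j]⇒i<j (ℤP.≤-reflexive (ℤP.+-comm i (- 1ℤ)))

  i<i+1 : ∀ i → i < i + 1ℤ
  i<i+1 i = ℤP.suc[i]≤j⇒i<j (ℤP.≤-reflexive (ℤP.+-comm 1ℤ i))

  i-1<i+1 : ∀ i → i - 1ℤ < i + 1ℤ
  i-1<i+1 i = ℤP.<-trans (i-1<i i) (i<i+1 i)

  i<j⇒i≤j-1 : ∀ {i j} → i < j → i ≤ j - 1ℤ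
  i<j⇒i≤j-1 {j = j} i<j = ℤP.≤-trans (ℤP.i<j⇒i≤pred[j] i<j) (ℤP.≤-reflexive (ℤP.+-comm (- 1ℤ) j))

  i<j⇒i+1≤j : ∀ {i j} → i < j → i + 1ℤ ≤ j
  i<j⇒i+1≤j {i} i<j = ℤP.≤-trans (ℤP.≤-reflexive (ℤP.+-comm i 1ℤ)) (ℤP.i<j⇒suc[i]≤j i<j)

  i<j⇒j≮i+1 : ∀ {i j} → i < j → ¬ j < i + 1ℤ
  i<j⇒j≮i+1 i<j j<i+1 = ℤP.<⇒≱ j<i+1 (i<j⇒i+1≤j i<j)

  i-1<j⇒i≤j : ∀ {i j} → i - 1ℤ < j → i ≤ j
  i-1<j⇒i≤j {i} i-1<j = subst (_≤ _) (i-1+1≡i i) (i<j⇒i+1≤j i-1<j)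
    where
      i-1+1≡i : ∀ i → i - 1ℤ + 1ℤ ≡ i
      i-1+1≡i = solve-∀

  i-1<j⇒j≮i : ∀ {i j} → i - 1ℤ < j → ¬ j < i
  i-1<j⇒j≮i i-1<j j<i = ℤP.<⇒≱ j<i (i-1<j⇒i≤j i-1<j)

  ≤⇒<⊎≡ : ∀ {i j} → i ≤ j → i < j ⊎ i ≡ j
  ≤⇒<⊎≡ {i} {j} i≤j with i ℤ.≟ j
  ... | yes i≡j = inj₂ i≡j
  ... | no i≢j  = inj₁ (ℤP.≤∧≢⇒< i≤j i≢j)

  data Around (i p : ℤ) : Set where
    below  : p < i - 1ℤ → Around i p
    left   : p ≡ i - 1ℤ → Around i p
    centre : p ≡ i → Around i p
    right  : p ≡ i + 1ℤ → Around i p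
    above  : i + 1ℤ < p → Around i p

  around : ∀ i p → Around i p
  around i p with ℤP.<-cmp p i
  ... | tri≈ _ p≡i _ = centre p≡i
  ... | tri< p<i _ _ with ℤP.<-cmp p (i - 1ℤ)
  ...   | tri< p<i-1 _ _ = below p<i-1
  ...   | tri≈ _ p≡i-1 _ = left p≡i-1
  ...   | tri> _ _ p>i-1 = ⊥-elim (i-1<j⇒j≮i p>i-1 p<i)
  around i p | tri> _ _ p>i with ℤP.<-cmp (i + 1ℤ) p
  ...   | tri< i+1<p _ _ = above i+1<p
  ...   | tri≈ _ i+1≡p _ = right (sym i+1≡p)
  ...   | tri> _ _ p<i+1 = ⊥-elim (i<j⇒j≮i+1 p>i p<i+1)

  module Topple (i : ℤ) (α β : ℕ) (rest : Config) where

    before after : Config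
    before = (i , α) ∷ (i , β) ∷ rest
    after  = (i - 1ℤ , α) ∷ (i + 1ℤ , β) ∷ rest

    occupancy-before-centre : occupancy i before ≡ 2 ℕ.+ occupancy i rest
    occupancy-before-centre =
      trans (occupancy-here i α ((i , β) ∷ rest)) (cong suc (occupancy-here i β rest))

    occupancy-before-off : ∀ {p} → i ≢ p → occupancy p before ≡ occupancy p rest
    occupancy-before-off i≢p =
      trans (occupancy-there α ((i , β) ∷ rest) i≢p) (occupancy-there β rest i≢p)

    occupancy-after-off : ∀ {p} → i - 1ℤ ≢ p → i + 1ℤ ≢ p → occupancy p after ≡ occupancy p rest
    occupancy-after-off ≢p₁ ≢p₂ =
      trans (occupancy-there α ((i + 1ℤ , β) ∷ rest) ≢p₁) (occupancy-there β rest ≢p₂)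

    occupancy-after-centre : occupancy i after ≡ occupancy i rest
    occupancy-after-centre = occupancy-after-off (ℤP.<⇒≢ (i-1<i i)) (>⇒≢ (i<i+1 i))

    occupancy-after-left : occupancy (i - 1ℤ) after ≡ suc (occupancy (i - 1ℤ) before)
    occupancy-after-left = begin
      occupancy (i - 1ℤ) after
        ≡⟨ occupancy-here (i - 1ℤ) α ((i + 1ℤ , β) ∷ rest) ⟩
      suc (occupancy (i - 1ℤ) ((i + 1ℤ , β) ∷ rest))
        ≡⟨ cong suc (occupancy-there β rest (>⇒≢ (i-1<i+1 i))) ⟩
      suc (occupancy (i - 1ℤ) rest)
        ≡⟨ cong suc (sym (occupancy-before-off (>⇒≢ (i-1<i i)))) ⟩
      suc (occupancy (i - 1ℤ) before)
        ∎
      where open ≡-Reasoning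

    occupancy-after-right : occupancy (i + 1ℤ) after ≡ suc (occupancy (i + 1ℤ) before)
    occupancy-after-right = begin
      occupancy (i + 1ℤ) after
        ≡⟨ occupancy-there α ((i + 1ℤ , β) ∷ rest) (ℤP.<⇒≢ (i-1<i+1 i)) ⟩
      occupancy (i + 1ℤ) ((i + 1ℤ , β) ∷ rest)
        ≡⟨ occupancy-here (i + 1ℤ) β rest ⟩
      suc (occupancy (i + 1ℤ) rest)
        ≡⟨ cong suc (sym (occupancy-before-off (ℤP.<⇒≢ (i<i+1 i)))) ⟩
      suc (occupancy (i + 1ℤ) before)
        ∎
      where open ≡-Reasoning

    occupancy-after-below : ∀ {p} → p < i - 1ℤ → occupancy p after ≡ occupancy p before
    occupancy-after-below p<i-1 = trans
      (occupancy-after-off (>⇒≢ p<i-1) (>⇒≢ (ℤP.<-trans p<i-1 (i-1<i+1 i))))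
      (sym (occupancy-before-off (>⇒≢ (ℤP.<-trans p<i-1 (i-1<i i)))))

    occupancy-after-above : ∀ {p} → i + 1ℤ < p → occupancy p after ≡ occupancy p before
    occupancy-after-above i+1<p = trans
      (occupancy-after-off (ℤP.<⇒≢ (ℤP.<-trans (i-1<i+1 i) i+1<p)) (ℤP.<⇒≢ i+1<p))
      (sym (occupancy-before-off (ℤP.<⇒≢ (ℤP.<-trans (i<i+1 i) i+1<p))))

  -- Sparse configurations

  record Sparse (c : Config) : Set where
    field
      at-most-two : ∀ p → occupancy p c ℕ.≤ 2
      doubles-separated : ∀ {p q} → p < q → occupancy p c ≡ 2 → occupancy q c ≡ 2 →
                          ∃[ z ] p < z × z < q × occupancy z c ≡ 0
  open Sparse

  Sparse-resp-↭ : ∀ {c d} → c ↭ d → Sparse c → Sparse d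
  Sparse-resp-↭ {c} {d} c↭d sparse = record
    { at-most-two = λ p → subst (ℕ._≤ 2) (moved p) (at-most-two sparse p)
    ; doubles-separated = λ {p} {q} p<q p₂ q₂ →
        let z , p<z , z<q , z₀ = doubles-separated sparse p<q (trans (moved p) p₂) (trans (moved q) q₂)
        in z , p<z , z<q , trans (sym (moved z)) z₀
    }
    where
      moved : ∀ p → occupancy p c ≡ occupancy p d
      moved p = occupancy-resp-↭ p c↭d

  module SparseTopple (i : ℤ) (α β : ℕ) (rest : Config)
                      (sparse : Sparse (Topple.before i α β rest)) where

    open Topple i α β rest public

    occupancy-rest-centre : occupancy i rest ≡ 0
    occupancy-rest-centre = ℕP.n≤0⇒n≡0 (ℕP.+-cancelˡ-≤ 2 _ _
      (subst (ℕ._≤ 2) occupancy-before-centre (at-most-two sparse i)))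

    occupancy-before-centre≡2 : occupancy i before ≡ 2
    occupancy-before-centre≡2 = trans occupancy-before-centre (cong (2 ℕ.+_) occupancy-rest-centre)

    occupancy-after-centre≡0 : occupancy i after ≡ 0
    occupancy-after-centre≡0 = trans occupancy-after-centre occupancy-rest-centre

    occupancy-before-left≤1 : occupancy (i - 1ℤ) before ℕ.≤ 1
    occupancy-before-left≤1 = ℕP.≤-pred (ℕP.≤∧≢⇒< (at-most-two sparse _) λ double →
      let _ , i-1<z , z<i , _ = doubles-separated sparse (i-1<i i) double occupancy-before-centre≡2
      in i-1<j⇒j≮i i-1<z z<i)

    occupancy-before-right≤1 : occupancy (i + 1ℤ) before ℕ.≤ 1
    occupancy-before-right≤1 = ℕP.≤-pred (ℕP.≤∧≢⇒< (at-most-two sparse _) λ double →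
      let _ , i<z , z<i+1 , _ = doubles-separated sparse (i<i+1 i) occupancy-before-centre≡2 double
      in i<j⇒j≮i+1 i<z z<i+1)

    at-most-two-after : ∀ p → occupancy p after ℕ.≤ 2
    at-most-two-after p with around i p
    ... | below p<i-1 = subst (ℕ._≤ 2) (sym (occupancy-after-below p<i-1)) (at-most-two sparse p)
    ... | left refl   = subst (ℕ._≤ 2) (sym occupancy-after-left) (s≤s occupancy-before-left≤1)
    ... | centre refl = subst (ℕ._≤ 2) (sym occupancy-after-centre≡0) z≤n
    ... | right refl  = subst (ℕ._≤ 2) (sym occupancy-after-right) (s≤s occupancy-before-right≤1)
    ... | above i+1<p = subst (ℕ._≤ 2) (sym (occupancy-after-above i+1<p)) (at-most-two sparse p)

    centre-not-double : occupancy i after ≢ 2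
    centre-not-double double with trans (sym occupancy-after-centre≡0) double
    ... | ()

    separated-left : ∀ {p q} → p < q → q < i → occupancy p after ≡ 2 → occupancy q after ≡ 2 →
                     ∃[ z ] p < z × z < q × occupancy z after ≡ 0
    separated-left {p} {q} p<q q<i p₂ q₂ with around i q
    ... | below q<i-1 =
      let z , p<z , z<q , z₀ = doubles-separated sparse p<q (double-before (ℤP.<-trans p<q q<i-1) p₂)
                                                            (double-before q<i-1 q₂)
      in z , p<z , z<q , trans (occupancy-after-below (ℤP.<-trans z<q q<i-1)) z₀
      where
        double-before : ∀ {p} → p < i - 1ℤ → occupancy p after ≡ 2 → occupancy p before ≡ 2
        double-before p<i-1 = trans (sym (occupancy-after-below p<i-1))
    ... | left refl =
      let z , p<z , z<i , z₀ = doubles-separated sparse (ℤP.<-trans p<q (i-1<i i))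
                                 (trans (sym (occupancy-after-below p<q)) p₂) occupancy-before-centre≡2
      in z , p<z , hole-below-left z<i z₀ , trans (occupancy-after-below (hole-below-left z<i z₀)) z₀
      where
        hole-below-left : ∀ {z} → z < i → occupancy z before ≡ 0 → z < i - 1ℤ
        hole-below-left z<i z₀ = ℤP.≤∧≢⇒< (i<j⇒i≤j-1 z<i) λ { refl →
          ℕP.0≢1+n (trans (sym z₀) (ℕP.suc-injective (trans (sym occupancy-after-left) q₂))) }
    ... | centre refl = ⊥-elim (ℤP.<-irrefl refl q<i)
    ... | right refl  = ⊥-elim (ℤP.<-asym q<i (i<i+1 i))
    ... | above i+1<q = ⊥-elim (ℤP.<-asym q<i (ℤP.<-trans (i<i+1 i) i+1<q))

    separated-right : ∀ {p q} → i < p → p < q → occupancy p after ≡ 2 → occupancy q after ≡ 2 →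
                      ∃[ z ] p < z × z < q × occupancy z after ≡ 0
    separated-right {p} {q} i<p p<q p₂ q₂ with around i p
    ... | above i+1<p =
      let z , p<z , z<q , z₀ = doubles-separated sparse p<q (double-before i+1<p p₂)
                                                            (double-before (ℤP.<-trans i+1<p p<q) q₂)
      in z , p<z , z<q , trans (occupancy-after-above (ℤP.<-trans i+1<p p<z)) z₀
      where
        double-before : ∀ {p} → i + 1ℤ < p → occupancy p after ≡ 2 → occupancy p before ≡ 2
        double-before i+1<p = trans (sym (occupancy-after-above i+1<p))
    ... | right refl =
      let z , i<z , z<q , z₀ = doubles-separated sparse (ℤP.<-trans i<p p<q) occupancy-before-centre≡2
                                 (trans (sym (occupancy-after-above p<q)) q₂)
      in z , hole-above-right i<z z₀ , z<q , trans (occupancy-after-above (hole-above-right i<z z₀)) z₀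
      where
        hole-above-right : ∀ {z} → i < z → occupancy z before ≡ 0 → i + 1ℤ < z
        hole-above-right i<z z₀ = ℤP.≤∧≢⇒< (i<j⇒i+1≤j i<z) λ { refl →
          ℕP.0≢1+n (trans (sym z₀) (ℕP.suc-injective (trans (sym occupancy-after-right) p₂))) }
    ... | below p<i-1 = ⊥-elim (ℤP.<-asym i<p (ℤP.<-trans p<i-1 (i-1<i i)))
    ... | left refl   = ⊥-elim (ℤP.<-asym i<p (i-1<i i))
    ... | centre refl = ⊥-elim (ℤP.<-irrefl refl i<p)

    sparse-after : Sparse after
    sparse-after = record { at-most-two = at-most-two-after ; doubles-separated = separated }
      where
        separated : ∀ {p q} → p < q → occupancy p after ≡ 2 → occupancy q after ≡ 2 →
                    ∃[ z ] p < z × z < q × occupancy z after ≡ 0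
        separated {p} {q} p<q p₂ q₂ with ℤP.<-cmp p i | ℤP.<-cmp q i
        ... | tri≈ _ refl _ | _             = ⊥-elim (centre-not-double p₂)
        ... | _             | tri≈ _ refl _ = ⊥-elim (centre-not-double q₂)
        ... | tri< p<i _ _  | tri> _ _ i<q  = i , p<i , i<q , occupancy-after-centre≡0
        ... | _             | tri< q<i _ _  = separated-left p<q q<i p₂ q₂
        ... | tri> _ _ i<p  | tri> _ _ _    = separated-right i<p p<q p₂ q₂

  Sparse-step : ∀ {c d} → Step c d → Sparse c → Sparse d
  Sparse-step (topple i α β rest _ c↭before) sparse =
    SparseTopple.sparse-after i α β rest (Sparse-resp-↭ c↭before sparse)

  -- The left front

  -- A mirrored step is a step only up to rearranging the list of chips.
  _⇝_ : Config → Config → Set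
  c ⇝ d = ∃[ e ] Step c e × e ↭ d

  Step⇒⇝ : ∀ {c d} → Step c d → c ⇝ d
  Step⇒⇝ step = _ , step , ↭-refl

  LeftBounded : ℤ → Config → Set
  LeftBounded b c = ∀ {p l} → (p , l) ∈ c → b ≤ p

  RightBounded : ℤ → Config → Set
  RightBounded b c = ∀ {p l} → (p , l) ∈ c → p ≤ b

  LeftBounded-resp-↭ : ∀ {b c d} → c ↭ d → LeftBounded b c → LeftBounded b d
  LeftBounded-resp-↭ c↭d bounded m = bounded (∈-resp-↭ (↭-sym c↭d) m)

  LeftBounded⇒unoccupied : ∀ {b p c} → LeftBounded b c → p < b → occupancy p c ≡ 0
  LeftBounded⇒unoccupied {c = []} _ _ = refl
  LeftBounded⇒unoccupied {b} {p} {(q , l) ∷ c} bounded p<b =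
    trans (occupancy-there l c q≢p) (LeftBounded⇒unoccupied (bounded ∘′ there) p<b)
    where
      q≢p : q ≢ p
      q≢p q≡p = ℤP.<⇒≱ p<b (subst (b ≤_) q≡p (bounded (here refl)))

  Singles : ℤ → ℤ → Config → Set
  Singles a w c = ∀ p → a ≤ p → p < w → occupancy p c ≡ 1

  Singles-resp-↭ : ∀ {a w c d} → c ↭ d → Singles a w c → Singles a w d
  Singles-resp-↭ c↭d singles p a≤p p<w = trans (sym (occupancy-resp-↭ p c↭d)) (singles p a≤p p<w)

  -- While the leftmost double w is right of the left end a, no chip is left of a and the chips at
  -- or left of w have labels ≥ ν; a topple at w moves w one step left together with its smaller
  -- chip. The topple at a leaves a chip at a - 1 that never moves again. Tracked asserts that the
  -- chip labelled ν is at or left of w, which forces the label of that settled chip to be ν.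
  module FrontInvariant (a : ℤ) (ν : ℕ) (Tracked : Set) where

    record Advancing (w : ℤ) (c : Config) : Set where
      field
        a≤w         : a ≤ w
        w-double    : occupancy w c ≡ 2
        singles-to-w : Singles a w c
        right-of-a  : LeftBounded a c
        labels-≥ν   : ∀ {p l} → (p , l) ∈ c → p ≤ w → ν ℕ.≤ l
        ν-left-of-w : Tracked → ∃[ p ] p ≤ w × (p , ν) ∈ c

    record Settled (z : ℤ) (c : Config) : Set where
      field
        label        : ℕ
        label-at-a-1 : (a - 1ℤ , label) ∈ c
        ν≤label      : ν ℕ.≤ label
        label≡ν      : Tracked → label ≡ ν
        right-of-a-1 : LeftBounded (a - 1ℤ) c
        a-1-single   : occupancy (a - 1ℤ) c ≡ 1
        a≤z          : a ≤ z
        z-empty      : occupancy z c ≡ 0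
        singles-to-z : Singles a z c

    Front : Config → Set
    Front c = (∃[ w ] Advancing w c) ⊎ (∃[ z ] Settled z c)

    open Advancing
    open Settled

    Front-resp-↭ : ∀ {c d} → c ↭ d → Front c → Front d
    Front-resp-↭ {c} {d} c↭d (inj₁ (w , adv)) = inj₁ (w , record
      { a≤w          = a≤w adv
      ; w-double     = trans (sym (occupancy-resp-↭ w c↭d)) (w-double adv)
      ; singles-to-w = Singles-resp-↭ c↭d (singles-to-w adv)
      ; right-of-a   = LeftBounded-resp-↭ c↭d (right-of-a adv)
      ; labels-≥ν    = λ m → labels-≥ν adv (∈-resp-↭ (↭-sym c↭d) m)
      ; ν-left-of-w  = λ t → let p , p≤w , m = ν-left-of-w adv t in p , p≤w , ∈-resp-↭ c↭d m
      })
    Front-resp-↭ {c} {d} c↭d (inj₂ (z , set)) = inj₂ (z , record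
      { label        = label set
      ; label-at-a-1 = ∈-resp-↭ c↭d (label-at-a-1 set)
      ; ν≤label      = ν≤label set
      ; label≡ν      = label≡ν set
      ; right-of-a-1 = LeftBounded-resp-↭ c↭d (right-of-a-1 set)
      ; a-1-single   = trans (sym (occupancy-resp-↭ (a - 1ℤ) c↭d)) (a-1-single set)
      ; a≤z          = a≤z set
      ; z-empty      = trans (sym (occupancy-resp-↭ z c↭d)) (z-empty set)
      ; singles-to-z = Singles-resp-↭ c↭d (singles-to-z set)
      })

    module FrontTopple (i : ℤ) (α β : ℕ) (rest : Config) (α<β : α ℕ.< β)
                       (sparse : Sparse (Topple.before i α β rest)) where

      open SparseTopple i α β rest sparse

      in-rest : ∀ {p l} → (p , l) ∈ before → p ≢ i → (p , l) ∈ rest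
      in-rest (here refl)         p≢i = ⊥-elim (p≢i refl)
      in-rest (there (here refl)) p≢i = ⊥-elim (p≢i refl)
      in-rest (there (there m))   _   = m

      LeftBounded-after : ∀ {b} → b ≤ i - 1ℤ → LeftBounded b before → LeftBounded b after
      LeftBounded-after b≤i-1 _       (here refl)         = b≤i-1
      LeftBounded-after b≤i-1 _       (there (here refl)) = ℤP.≤-trans b≤i-1 (ℤP.<⇒≤ (i-1<i+1 i))
      LeftBounded-after _     bounded (there (there m))   = bounded (there (there m))

      ν-at-i : (i , ν) ∈ before → ν ℕ.≤ α → ν ≡ α
      ν-at-i (here refl)         _   = refl
      ν-at-i (there (here refl)) β≤α = ⊥-elim (ℕP.<⇒≱ α<β β≤α)
      ν-at-i (there (there m))   _   = ⊥-elim (unoccupied⇒∉ occupancy-rest-centre m)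

      double-not-left-of-i : ∀ {w} → Advancing w before → ¬ i < w
      double-not-left-of-i adv i<w with trans (sym (singles-to-w adv i (right-of-a adv (here refl)) i<w))
                                              occupancy-before-centre≡2
      ... | ()

      advancing-far : ∀ {w} → w < i → Advancing w before → Advancing w after
      advancing-far {w} w<i adv = record
        { a≤w          = a≤w adv
        ; w-double     = trans (occupancy-after-below w<i-1) (w-double adv)
        ; singles-to-w = λ p a≤p p<w →
            trans (occupancy-after-below (ℤP.<-trans p<w w<i-1)) (singles-to-w adv p a≤p p<w)
        ; right-of-a   = LeftBounded-after (ℤP.≤-trans (a≤w adv) (ℤP.<⇒≤ w<i-1)) (right-of-a adv)
        ; labels-≥ν    = labels
        ; ν-left-of-w  = λ t → let p , p≤w , m = ν-left-of-w adv t
                              in p , p≤w , there (there (in-rest m (ℤP.<⇒≢ (ℤP.≤-<-trans p≤w w<i))))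
        }
        where
          w<i-1 : w < i - 1ℤ
          w<i-1 = ℤP.≤∧≢⇒< (i<j⇒i≤j-1 w<i) λ { refl →
            let _ , i-1<z , z<i , _ = doubles-separated sparse w<i (w-double adv) occupancy-before-centre≡2
            in i-1<j⇒j≮i i-1<z z<i }
          labels : ∀ {p l} → (p , l) ∈ after → p ≤ w → ν ℕ.≤ l
          labels (here refl)         p≤w = ⊥-elim (ℤP.<⇒≱ w<i-1 p≤w)
          labels (there (here refl)) p≤w = ⊥-elim (ℤP.<⇒≱ (ℤP.<-trans w<i (i<i+1 i)) p≤w)
          labels (there (there m))   p≤w = labels-≥ν adv (there (there m)) p≤w

      ν-from-i : Advancing i before → Tracked → ν ≡ α ⊎ ∃[ p ] p < i × (p , ν) ∈ rest
      ν-from-i adv t with ν-left-of-w adv t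
      ... | p , p≤i , m with ≤⇒<⊎≡ p≤i
      ...   | inj₁ p<i  = inj₂ (p , p<i , in-rest m (ℤP.<⇒≢ p<i))
      ...   | inj₂ refl = inj₁ (ν-at-i m (labels-≥ν adv (here refl) ℤP.≤-refl))

      advancing-left : a < i → Advancing i before → Advancing (i - 1ℤ) after
      advancing-left a<i adv = record
        { a≤w          = a≤i-1
        ; w-double     = trans occupancy-after-left (cong suc (singles-to-w adv (i - 1ℤ) a≤i-1 (i-1<i i)))
        ; singles-to-w = λ p a≤p p<i-1 → trans (occupancy-after-below p<i-1)
                                               (singles-to-w adv p a≤p (ℤP.<-trans p<i-1 (i-1<i i)))
        ; right-of-a   = LeftBounded-after a≤i-1 (right-of-a adv)
        ; labels-≥ν    = labels
        ; ν-left-of-w  = tracked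
        }
        where
          a≤i-1 : a ≤ i - 1ℤ
          a≤i-1 = i<j⇒i≤j-1 a<i
          labels : ∀ {p l} → (p , l) ∈ after → p ≤ i - 1ℤ → ν ℕ.≤ l
          labels (here refl)         _     = labels-≥ν adv (here refl) ℤP.≤-refl
          labels (there (here refl)) p≤i-1 = ⊥-elim (ℤP.<⇒≱ (i-1<i+1 i) p≤i-1)
          labels (there (there m))   p≤i-1 =
            labels-≥ν adv (there (there m)) (ℤP.≤-trans p≤i-1 (ℤP.<⇒≤ (i-1<i i)))
          tracked : Tracked → ∃[ p ] p ≤ i - 1ℤ × (p , ν) ∈ after
          tracked t with ν-from-i adv t
          ... | inj₁ refl            = i - 1ℤ , ℤP.≤-refl , here refl
          ... | inj₂ (p , p<i , m) = p , i<j⇒i≤j-1 p<i , there (there m)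

      advancing-settles : a ≡ i → Advancing i before → Settled i after
      advancing-settles a≡i adv = record
        { label        = α
        ; label-at-a-1 = subst (λ x → (x , α) ∈ after) i-1≡a-1 (here refl)
        ; ν≤label      = labels-≥ν adv (here refl) ℤP.≤-refl
        ; label≡ν      = tracked
        ; right-of-a-1 = LeftBounded-after (ℤP.≤-reflexive (sym i-1≡a-1))
                           (λ m → ℤP.<⇒≤ (ℤP.<-≤-trans (i-1<i a) (right-of-a adv m)))
        ; a-1-single   = subst (λ x → occupancy x after ≡ 1) i-1≡a-1
                           (trans occupancy-after-left (cong suc (LeftBounded⇒unoccupied (right-of-a adv) i-1<a)))
        ; a≤z          = ℤP.≤-reflexive a≡i
        ; z-empty      = occupancy-after-centre≡0
        ; singles-to-z = λ p a≤p p<i → ⊥-elim (ℤP.<⇒≱ p<i (subst (_≤ p) a≡i a≤p))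
        }
        where
          i-1≡a-1 : i - 1ℤ ≡ a - 1ℤ
          i-1≡a-1 = cong (_- 1ℤ) (sym a≡i)
          i-1<a : i - 1ℤ < a
          i-1<a = subst (i - 1ℤ <_) (sym a≡i) (i-1<i i)
          tracked : Tracked → α ≡ ν
          tracked t with ν-from-i adv t
          ... | inj₁ ν≡α             = sym ν≡α
          ... | inj₂ (p , p<i , m) =
            ⊥-elim (ℤP.<⇒≱ p<i (subst (_≤ p) a≡i (right-of-a adv (there (there m)))))

      settled-a-1<i : ∀ {z} → Settled z before → a - 1ℤ < i
      settled-a-1<i set = ℤP.≤∧≢⇒< (right-of-a-1 set (here refl)) λ a-1≡i →
        ℕP.1+n≢n {1} (trans (sym (subst (λ x → occupancy x before ≡ 2) (sym a-1≡i)
                                        occupancy-before-centre≡2))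
                            (a-1-single set))

      settled-a≤i : ∀ {z} → Settled z before → a ≤ i
      settled-a≤i set = i-1<j⇒i≤j (settled-a-1<i set)

      settled-z<i : ∀ {z} → Settled z before → z < i
      settled-z<i {z} set with ℤP.<-cmp z i
      ... | tri< z<i _ _ = z<i
      ... | tri≈ _ refl _ with trans (sym (z-empty set)) occupancy-before-centre≡2
      ...   | ()
      settled-z<i {z} set | tri> _ _ i<z
        with trans (sym (singles-to-z set i (settled-a≤i set) i<z)) occupancy-before-centre≡2
      ...   | ()

      settled-label-after : ∀ {z} (set : Settled z before) → (a - 1ℤ , label set) ∈ after
      settled-label-after set = there (there (in-rest (label-at-a-1 set) (ℤP.<⇒≢ (settled-a-1<i set))))

      settled-bounded-after : ∀ {z} → Settled z before → LeftBounded (a - 1ℤ) after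
      settled-bounded-after set =
        LeftBounded-after (ℤP.+-monoˡ-≤ (- 1ℤ) (settled-a≤i set)) (right-of-a-1 set)

      settled-far : ∀ {z} → z < i - 1ℤ → Settled z before → Settled z after
      settled-far z<i-1 set = record
        { label        = label set
        ; label-at-a-1 = settled-label-after set
        ; ν≤label      = ν≤label set
        ; label≡ν      = label≡ν set
        ; right-of-a-1 = settled-bounded-after set
        ; a-1-single   = trans (occupancy-after-below a-1<i-1) (a-1-single set)
        ; a≤z          = a≤z set
        ; z-empty      = trans (occupancy-after-below z<i-1) (z-empty set)
        ; singles-to-z = λ p a≤p p<z → trans (occupancy-after-below (ℤP.<-trans p<z z<i-1))
                                             (singles-to-z set p a≤p p<z)
        }
        where
          a-1<i-1 : a - 1ℤ < i - 1ℤ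
          a-1<i-1 = ℤP.<-≤-trans (i-1<i a) (ℤP.≤-trans (a≤z set) (ℤP.<⇒≤ z<i-1))

      settled-adjacent : Settled (i - 1ℤ) before → Settled i after
      settled-adjacent set = record
        { label        = label set
        ; label-at-a-1 = settled-label-after set
        ; ν≤label      = ν≤label set
        ; label≡ν      = label≡ν set
        ; right-of-a-1 = settled-bounded-after set
        ; a-1-single   = trans (occupancy-after-below (ℤP.<-≤-trans (i-1<i a) (a≤z set))) (a-1-single set)
        ; a≤z          = settled-a≤i set
        ; z-empty      = occupancy-after-centre≡0
        ; singles-to-z = singles
        }
        where
          singles : Singles a i after
          singles p a≤p p<i with ≤⇒<⊎≡ (i<j⇒i≤j-1 p<i)
          ... | inj₁ p<i-1 = trans (occupancy-after-below p<i-1) (singles-to-z set p a≤p p<i-1)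
          ... | inj₂ refl  = trans occupancy-after-left (cong suc (z-empty set))

      settled-step : ∀ {z} → Settled z before → ∃[ z′ ] Settled z′ after
      settled-step {z} set with ≤⇒<⊎≡ (i<j⇒i≤j-1 (settled-z<i set))
      ... | inj₁ z<i-1 = z , settled-far z<i-1 set
      ... | inj₂ refl  = i , settled-adjacent set

      front-after : Front before → Front after
      front-after (inj₂ (_ , set)) = inj₂ (settled-step set)
      front-after (inj₁ (w , adv)) with ℤP.<-cmp w i
      ... | tri< w<i _ _ = inj₁ (w , advancing-far w<i adv)
      ... | tri> _ _ i<w = ⊥-elim (double-not-left-of-i adv i<w)
      ... | tri≈ _ refl _ with ≤⇒<⊎≡ (a≤w adv)
      ...   | inj₁ a<i = inj₁ (i - 1ℤ , advancing-left a<i adv)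
      ...   | inj₂ a≡i = inj₂ (i , advancing-settles a≡i adv)

    Front-step : ∀ {c d} → Step c d → Sparse c → Front c → Front d
    Front-step (topple i α β rest α<β c↭before) sparse front =
      FrontTopple.front-after i α β rest α<β (Sparse-resp-↭ c↭before sparse)
                                             (Front-resp-↭ c↭before front)

    Front-stable : ∀ {c} → (∀ p → occupancy p c ℕ.≤ 1) → Front c → ∃[ z ] Settled z c
    Front-stable at-most-one (inj₁ (w , adv)) =
      ⊥-elim (ℕP.<⇒≱ (ℕP.≤-reflexive (sym (w-double adv))) (at-most-one w))
    Front-stable _           (inj₂ settled)   = settled

    settles : ∀ {c d} → Star _⇝_ c d → Sparse c → Front c → (∀ p → occupancy p d ℕ.≤ 1) →
              ∃[ z ] Settled z d
    settles ε                       _      front stable = Front-stable stable front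
    settles ((e , step , e↭d) ◅ run) sparse front stable =
      settles run (Sparse-resp-↭ e↭d (Sparse-step step sparse))
                  (Front-resp-↭ e↭d (Front-step step sparse front)) stable

  -- Mirror images

  LabelsAtMost : ℕ → Config → Set
  LabelsAtMost K c = ∀ {p l} → (p , l) ∈ c → l ℕ.≤ K

  LabelsAtMost-step : ∀ {K c d} → Step c d → LabelsAtMost K c → LabelsAtMost K d
  LabelsAtMost-step {K} (topple i α β rest _ c↭before) bound = λ where
      (here refl)         → bound-before (here refl)
      (there (here refl)) → bound-before (there (here refl))
      (there (there m))   → bound-before (there (there m))
    where
      bound-before : LabelsAtMost K (Topple.before i α β rest)
      bound-before m = bound (∈-resp-↭ (↭-sym c↭before) m)

  LabelsAtMost-star : ∀ {K c d} → Star Step c d → LabelsAtMost K c → LabelsAtMost K d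
  LabelsAtMost-star ε            bound = bound
  LabelsAtMost-star (step ◅ run) bound = LabelsAtMost-star run (LabelsAtMost-step step bound)

  -- Reflection of the line together with the label order; K ∸_ reverses that order only on labels ≤ K.
  mirror : ℕ → Config → Config
  mirror K = map λ chip → - proj₁ chip , K ∸ proj₂ chip

  mirror-step : ∀ {K c d} → LabelsAtMost K c → Step c d → mirror K c ⇝ mirror K d
  mirror-step {K} {c} bound (topple i α β rest α<β c↭before) =
    _ , topple (- i) (K ∸ β) (K ∸ α) (mirror K rest) (ℕP.∸-monoʳ-< α<β β≤K) mirrored-before ,
    mirrored-after
    where
      β≤K : β ℕ.≤ K
      β≤K = bound (∈-resp-↭ (↭-sym c↭before) (there (here refl)))
      mirrored-before : mirror K c ↭ (- i , K ∸ β) ∷ (- i , K ∸ α) ∷ mirror K rest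
      mirrored-before = ↭-trans (map⁺ _ c↭before) (swap _ _ ↭-refl)
      -[i-1]≡-i+1 : ∀ i → - (i - 1ℤ) ≡ - i + 1ℤ
      -[i-1]≡-i+1 = solve-∀
      -[i+1]≡-i-1 : ∀ i → - (i + 1ℤ) ≡ - i - 1ℤ
      -[i+1]≡-i-1 = solve-∀
      mirrored-after : (- i - 1ℤ , K ∸ β) ∷ (- i + 1ℤ , K ∸ α) ∷ mirror K rest ↭
                       mirror K (Topple.after i α β rest)
      mirrored-after rewrite -[i-1]≡-i+1 i | -[i+1]≡-i-1 i = swap _ _ ↭-refl

  mirror-star : ∀ {K c d} → LabelsAtMost K c → Star Step c d → Star _⇝_ (mirror K c) (mirror K d)
  mirror-star _     ε             = ε
  mirror-star bound (step ◅ run) = mirror-step bound step ◅ mirror-star (LabelsAtMost-step step bound) run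

  positions-mirror : ∀ K c → map proj₁ (mirror K c) ≡ map -_ (map proj₁ c)
  positions-mirror K c = trans (sym (map-∘ c)) (map-∘ c)

  Stable-mirror : ∀ {K c} → Stable c → Stable (mirror K c)
  Stable-mirror {K} {c} stable =
    subst Unique (sym (positions-mirror K c)) (Unique.map⁺ ℤP.neg-injective stable)

  Reads⇒head≡leftmost : ∀ {b l c w} → (b , l) ∈ c → LeftBounded b c → Reads c w → head w ≡ just l
  Reads⇒head≡leftmost {b} {l} m bounded (s , c↭s , sorted , refl) =
    sorted-head (∈-resp-↭ c↭s m) (LeftBounded-resp-↭ c↭s bounded) sorted
    where
      sorted-head : ∀ {s} → (b , l) ∈ s → LeftBounded b s → Linked _<_ (map proj₁ s) →
                    head (map proj₂ s) ≡ just l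
      sorted-head (here refl) _       _ = refl
      sorted-head (there m)   bounded sorted with Linked⇒AllPairs ℤP.<-trans sorted
      ... | first<rest ∷ _ = ⊥-elim (ℤP.<⇒≱ (All.lookup (All.map⁻ first<rest) m) (bounded (here refl)))

  Reads⇒last≡rightmost : ∀ {b l c w} → (b , l) ∈ c → RightBounded b c → Reads c w → last w ≡ just l
  Reads⇒last≡rightmost {b} {l} m bounded (s , c↭s , sorted , refl) =
    sorted-last (∈-resp-↭ c↭s m) (λ m′ → bounded (∈-resp-↭ (↭-sym c↭s) m′)) sorted
    where
      sorted-last : ∀ {s} → (b , l) ∈ s → RightBounded b s → Linked _<_ (map proj₁ s) →
                    last (map proj₂ s) ≡ just l
      sorted-last {_ ∷ []}    (here refl) _       _            = refl
      sorted-last {_ ∷ _ ∷ _} (here refl) bounded (p₀<p₁ ∷ _)  = ⊥-elim (ℤP.<⇒≱ p₀<p₁ (bounded (there (here refl))))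
      sorted-last {_ ∷ _ ∷ _} (there m)   bounded (_ ∷ sorted) = sorted-last m (bounded ∘′ there) sorted

  record OnePerSite (lo hi : ℤ) (c : Config) : Set where
    field
      stable : Stable c
      within : ∀ {p l} → (p , l) ∈ c → lo ≤ p × p ≤ hi
      covers : ∀ p → lo ≤ p → p ≤ hi → ∃[ l ] (p , l) ∈ c
  open OnePerSite

  OnePerSite⇒occupancy≡1 : ∀ {lo hi c p} → OnePerSite lo hi c → lo ≤ p → p ≤ hi → occupancy p c ≡ 1
  OnePerSite⇒occupancy≡1 {p = p} spread lo≤p p≤hi =
    ℕP.≤-antisym (Stable⇒occupancy≤1 (stable spread) p) (∈⇒occupied (proj₂ (covers spread p lo≤p p≤hi)))

  OnePerSite-mirror : ∀ {lo hi c} K → OnePerSite lo hi c → OnePerSite (- hi) (- lo) (mirror K c)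
  OnePerSite-mirror {lo} {hi} {c} K spread = record
    { stable = Stable-mirror (stable spread)
    ; within = mirrored-within
    ; covers = λ p -hi≤p p≤-lo →
        let l , m = covers spread (- p) (i≤-j⇒j≤-i p≤-lo) (-i≤j⇒-j≤i -hi≤p)
        in K ∸ l , subst (λ x → (x , K ∸ l) ∈ mirror K c) (ℤP.neg-involutive p) (∈-map⁺ _ m)
    }
    where
      i≤-j⇒j≤-i : ∀ {i j} → i ≤ - j → j ≤ - i
      i≤-j⇒j≤-i {j = j} i≤-j = subst (_≤ _) (ℤP.neg-involutive j) (ℤP.neg-mono-≤ i≤-j)
      -i≤j⇒-j≤i : ∀ {i j} → - i ≤ j → - j ≤ i
      -i≤j⇒-j≤i {i} -i≤j = subst (_ ≤_) (ℤP.neg-involutive i) (ℤP.neg-mono-≤ -i≤j)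
      mirrored-within : ∀ {p l} → (p , l) ∈ mirror K c → - hi ≤ p × p ≤ - lo
      mirrored-within m with ∈-map⁻ _ m
      ... | (q , _) , m′ , refl =
        let lo≤q , q≤hi = within spread m′ in ℤP.neg-mono-≤ q≤hi , ℤP.neg-mono-≤ lo≤q

  Sparse-seeded : ∀ {s l c} → Stable c → Sparse ((s , l) ∷ c)
  Sparse-seeded {s} {l} {c} stable = record { at-most-two = at-most-two′ ; doubles-separated = separated }
    where
      at-most-two′ : ∀ p → occupancy p ((s , l) ∷ c) ℕ.≤ 2
      at-most-two′ p with s ℤ.≟ p
      ... | yes refl = s≤s (Stable⇒occupancy≤1 stable s)
      ... | no _     = ℕP.m≤n⇒m≤1+n (Stable⇒occupancy≤1 stable p)
      double⇒seed : ∀ {p} → occupancy p ((s , l) ∷ c) ≡ 2 → s ≡ p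
      double⇒seed {p} double with s ℤ.≟ p
      ... | yes s≡p = s≡p
      ... | no _    = ⊥-elim (ℕP.<⇒≱ (ℕP.≤-reflexive (sym double)) (Stable⇒occupancy≤1 stable p))
      separated : ∀ {p q} → p < q → occupancy p ((s , l) ∷ c) ≡ 2 → occupancy q ((s , l) ∷ c) ≡ 2 →
                  ∃[ z ] p < z × z < q × occupancy z ((s , l) ∷ c) ≡ 0
      separated p<q p₂ q₂ = ⊥-elim (ℤP.<-irrefl (trans (sym (double⇒seed p₂)) (double⇒seed q₂)) p<q)

  Front-seeded : ∀ {lo hi s r c} (ν : ℕ) (Tracked : Set) → OnePerSite lo hi c → lo ≤ s → s ≤ hi →
                 (∀ {p l} → (p , l) ∈ (s , r) ∷ c → p ≤ s → ν ℕ.≤ l) →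
                 (Tracked → ∃[ p ] p ≤ s × (p , ν) ∈ (s , r) ∷ c) →
                 FrontInvariant.Front lo ν Tracked ((s , r) ∷ c)
  Front-seeded {lo} {hi} {s} {r} {c} ν Tracked spread lo≤s s≤hi labels tracked = inj₁ (s , record
    { a≤w          = lo≤s
    ; w-double     = trans (occupancy-here s r c) (cong suc (OnePerSite⇒occupancy≡1 spread lo≤s s≤hi))
    ; singles-to-w = λ p lo≤p p<s →
        trans (occupancy-there r c (>⇒≢ p<s))
              (OnePerSite⇒occupancy≡1 spread lo≤p (ℤP.≤-trans (ℤP.<⇒≤ p<s) s≤hi))
    ; right-of-a   = λ { (here refl) → lo≤s ; (there m) → proj₁ (within spread m) }
    ; labels-≥ν    = labels
    ; ν-left-of-w  = tracked
    })
    where open FrontInvariant lo ν Tracked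

  leftmost-chip : ∀ {lo hi s r c d} (ν : ℕ) (Tracked : Set) → OnePerSite lo hi c → lo ≤ s → s ≤ hi →
                  (∀ {p l} → (p , l) ∈ (s , r) ∷ c → p ≤ s → ν ℕ.≤ l) →
                  (Tracked → ∃[ p ] p ≤ s × (p , ν) ∈ (s , r) ∷ c) →
                  Star _⇝_ ((s , r) ∷ c) d → Stable d →
                  ∃[ l ] (lo - 1ℤ , l) ∈ d × LeftBounded (lo - 1ℤ) d × ν ℕ.≤ l × (Tracked → l ≡ ν)
  leftmost-chip {lo} ν Tracked spread lo≤s s≤hi labels tracked run d-stable
    with FrontInvariant.settles lo ν Tracked run (Sparse-seeded (stable spread))
           (Front-seeded ν Tracked spread lo≤s s≤hi labels tracked) (Stable⇒occupancy≤1 d-stable)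
  ... | _ , settled =
    label settled , label-at-a-1 settled , right-of-a-1 settled , ν≤label settled , label≡ν settled
    where open FrontInvariant.Settled

  head-label : ∀ {lo hi s r c d w} (ν : ℕ) (Tracked : Set) → OnePerSite lo hi c → lo ≤ s → s ≤ hi →
               (∀ {p l} → (p , l) ∈ (s , r) ∷ c → p ≤ s → ν ℕ.≤ l) →
               (Tracked → ∃[ p ] p ≤ s × (p , ν) ∈ (s , r) ∷ c) →
               Star Step ((s , r) ∷ c) d → Stable d → Reads d w →
               ∃[ l ] head w ≡ just l × ν ℕ.≤ l × (Tracked → l ≡ ν)
  head-label ν Tracked spread lo≤s s≤hi labels tracked run d-stable reads =
    let l , m , bounded , ν≤l , l≡ν = leftmost-chip ν Tracked spread lo≤s s≤hi labels tracked
                                                    (Star.map Step⇒⇝ run) d-stable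
    in l , Reads⇒head≡leftmost m bounded reads , ν≤l , l≡ν

  -- The mirror image of the chip labelled K is the chip labelled 0, which the left-hand argument
  -- (with ν = 0) puts leftmost.
  last-label : ∀ {lo hi s r c d w} K → OnePerSite lo hi c → lo ≤ s → s ≤ hi →
               LabelsAtMost K ((s , r) ∷ c) → ∀ {q} → s ≤ q → (q , K) ∈ (s , r) ∷ c →
               Star Step ((s , r) ∷ c) d → Stable d → Reads d w → last w ≡ just K
  last-label {hi = hi} {s} {r} {c} {d} K spread lo≤s s≤hi bound {q} s≤q q-K run d-stable reads
    with leftmost-chip 0 ⊤ (OnePerSite-mirror K spread) (ℤP.neg-mono-≤ s≤hi) (ℤP.neg-mono-≤ lo≤s)
           (λ _ _ → z≤n) (λ _ → - q , ℤP.neg-mono-≤ s≤q , mirrored-K)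
           (mirror-star bound run) (Stable-mirror d-stable)
    where
      mirrored-K : (- q , 0) ∈ mirror K ((s , r) ∷ c)
      mirrored-K = subst (λ x → (- q , x) ∈ mirror K ((s , r) ∷ c)) (ℕP.n∸n≡0 K) (∈-map⁺ _ q-K)
  ... | l , m , bounded , _ , l≡0 with ∈-map⁻ _ m
  ...   | (q′ , l′) , m′ , chip≡ =
    Reads⇒last≡rightmost (subst (λ x → (q′ , x) ∈ d) l′≡K m′) rightmost reads
    where
      l′≡K : l′ ≡ K
      l′≡K = ℕP.≤-antisym (LabelsAtMost-star run bound m′)
                           (ℕP.m∸n≡0⇒m≤n (trans (sym (cong proj₂ chip≡)) (l≡0 tt)))
      rightmost : RightBounded q′ d
      rightmost m″ = ℤP.neg-cancel-≤ (subst (_≤ _) (cong proj₁ chip≡) (bounded (∈-map⁺ _ m″)))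

  -- The configuration π^(r)

  module Shift (k : ℕ) where

    shift : ℕ → ℤ
    shift a = + a - + k

    shift-mono-≤ : ∀ {a b} → a ℕ.≤ b → shift a ≤ shift b
    shift-mono-≤ a≤b = ℤP.+-monoˡ-≤ (- + k) (ℤ.+≤+ a≤b)

    shift-unshift : ∀ a → shift a + + k ≡ + a
    shift-unshift a = x-y+y≡x (+ a) (+ k)
      where
        x-y+y≡x : ∀ x y → x - y + y ≡ x
        x-y+y≡x = solve-∀

    shift-cancel-≤ : ∀ {a b} → shift a ≤ shift b → a ℕ.≤ b
    shift-cancel-≤ {a} {b} le = ℤP.drop‿+≤+
      (subst₂ _≤_ (shift-unshift a) (shift-unshift b) (ℤP.+-monoˡ-≤ (+ k) le))

    shift-injective : ∀ {a b} → shift a ≡ shift b → a ≡ b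
    shift-injective {a} {b} eq = ℤP.+-injective
      (trans (sym (shift-unshift a)) (trans (cong (_+ + k) eq) (shift-unshift b)))

    shift-self : shift k ≡ 0ℤ
    shift-self = ℤP.+-inverseʳ (+ k)

    shift-zero : shift 0 ≡ - + k
    shift-zero = ℤP.+-identityˡ (- + k)

    shift-onto : ∀ {p} → - + k ≤ p → ∃[ a ] shift a ≡ p
    shift-onto {p} -k≤p = ℤ.∣ p + + k ∣ , (begin
      + ℤ.∣ p + + k ∣ - + k ≡⟨ cong (_- + k) (ℤP.0≤i⇒+∣i∣≡i 0≤p+k) ⟩
      p + + k - + k         ≡⟨ x+y-y≡x p (+ k) ⟩
      p                     ∎)
      where
        open ≡-Reasoning
        x+y-y≡x : ∀ x y → x + y - y ≡ x
        x+y-y≡x = solve-∀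
        0≤p+k : 0ℤ ≤ p + + k
        0≤p+k = subst (_≤ p + + k) (ℤP.+-inverseˡ (+ k)) (ℤP.+-monoˡ-≤ (+ k) -k≤p)

  relabel-< : ∀ {r v} → v ℕ.< r → relabel r v ≡ v
  relabel-< {r} {v} v<r with v ℕ.<ᵇ r | ℕP.<⇒<ᵇ v<r
  ... | true | _ = refl

  relabel-≥ : ∀ {r v} → r ℕ.≤ v → relabel r v ≡ suc v
  relabel-≥ {r} {v} r≤v with v ℕ.<ᵇ r | ℕP.<ᵇ⇒< v r
  ... | true  | v<r = ⊥-elim (ℕP.<⇒≱ (v<r tt) r≤v)
  ... | false | _   = refl

  v≤relabel : ∀ r v → v ℕ.≤ relabel r v
  v≤relabel r v with v ℕ.<ᵇ r
  ... | true  = ℕP.≤-refl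
  ... | false = ℕP.n≤1+n v

  relabel≤suc : ∀ r v → relabel r v ℕ.≤ suc v
  relabel≤suc r v with v ℕ.<ᵇ r
  ... | true  = ℕP.n≤1+n v
  ... | false = ℕP.≤-refl

  module _ {n} (π : Permutation′ n) where

    val-injective : ∀ {i j} → val π i ≡ val π j → i ≡ j
    val-injective {i} {j} eq = begin
      i                        ≡⟨ inverseˡ π ⟨
      π ⟨$⟩ˡ (π ⟨$⟩ʳ i)        ≡⟨ cong (π ⟨$⟩ˡ_) (Fin.toℕ-injective (ℕP.suc-injective eq)) ⟩
      π ⟨$⟩ˡ (π ⟨$⟩ʳ j)        ≡⟨ inverseˡ π ⟩
      j                        ∎
      where open ≡-Reasoning

    val-onto : ∀ {v} → v ℕ.< n → ∃[ j ] val π j ≡ suc v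
    val-onto v<n =
      π ⟨$⟩ˡ fromℕ< v<n , cong suc (trans (cong toℕ (inverseʳ π)) (Fin.toℕ-fromℕ< v<n))

    val≤n : ∀ j → val π j ℕ.≤ n
    val≤n j = Fin.toℕ<n (π ⟨$⟩ʳ j)

  module Seeded {n} .{{_ : ℕ.NonZero n}} (π : Permutation′ n) (r : ℕ) where

    offset : ℕ
    offset = (n ∸ 1) / 2

    open Shift offset

    site : Fin n → ℤ
    site j = shift (toℕ j)

    chip : Fin n → Chip
    chip j = site j , relabel r (val π j)

    line : Config
    line = map chip (allFin n)

    lo hi : ℤ
    lo = - + offset
    hi = shift (n ∸ 1)

    line-OnePerSite : OnePerSite lo hi line
    line-OnePerSite = record
      { stable = subst Unique (map-∘ (allFin n))
                       (Unique.map⁺ (λ eq → Fin.toℕ-injective (shift-injective eq)) (Unique.allFin⁺ n))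
      ; within = line-within
      ; covers = line-covers
      }
      where
        line-within : ∀ {p l} → (p , l) ∈ line → lo ≤ p × p ≤ hi
        line-within m with ∈-map⁻ chip m
        ... | j , _ , refl =
          subst (_≤ site j) shift-zero (shift-mono-≤ z≤n) , shift-mono-≤ (Fin.toℕ≤pred[n] j)
        line-covers : ∀ p → lo ≤ p → p ≤ hi → ∃[ l ] (p , l) ∈ line
        line-covers p lo≤p p≤hi =
          let a , a↦p = shift-onto lo≤p
              a<n = ℕP.m≤pred[n]⇒suc[m]≤n (shift-cancel-≤ (subst (_≤ hi) (sym a↦p) p≤hi))
              j = fromℕ< a<n
          in relabel r (val π j) , subst (λ x → (x , relabel r (val π j)) ∈ line)
                                         (trans (cong shift (Fin.toℕ-fromℕ< a<n)) a↦p)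
                                         (∈-map⁺ chip (∈-allFin j))

    lo≤0 : lo ≤ 0ℤ
    lo≤0 = ℤP.neg-≤-pos

    0≤hi : 0ℤ ≤ hi
    0≤hi = subst (_≤ hi) shift-self (shift-mono-≤ (m/n≤m (n ∸ 1) 2))

    site≤0 : ∀ {j} → toℕ j ℕ.≤ offset → site j ≤ 0ℤ
    site≤0 {j} le = subst (site j ≤_) shift-self (shift-mono-≤ le)

    site≤0⁻¹ : ∀ {j} → site j ≤ 0ℤ → toℕ j ℕ.≤ offset
    site≤0⁻¹ {j} le = shift-cancel-≤ (subst (site j ≤_) (sym shift-self) le)

    0≤site : ∀ {j} → offset ℕ.≤ toℕ j → 0ℤ ≤ site j
    0≤site {j} le = subst (_≤ site j) shift-self (shift-mono-≤ le)

    chip∈initial : ∀ j → chip j ∈ initConfig π r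
    chip∈initial j = there (∈-map⁺ chip (∈-allFin j))

    initial-chips : ∀ {p l} → (p , l) ∈ initConfig π r →
                    l ≡ r ⊎ ∃[ j ] p ≡ site j × l ≡ relabel r (val π j)
    initial-chips (here refl) = inj₁ refl
    initial-chips (there m) with ∈-map⁻ chip m
    ... | j , _ , refl = inj₂ (j , refl , refl)

    Topples⇒head≡1 : 2 ℕ.≤ r → (∀ j → val π j ≡ 1 → pos j ℕ.≤ suc offset) →
                     ∀ w → Topples π r w → head w ≡ just 1
    Topples⇒head≡1 2≤r one-left w (_ , run , d-stable , reads) =
      let _ , head≡l , _ , l≡1 = head-label 1 ⊤ line-OnePerSite lo≤0 0≤hi labels≥1 (λ _ → one-near)
                                            run d-stable reads
      in trans head≡l (cong just (l≡1 tt))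
      where
        labels≥1 : ∀ {p l} → (p , l) ∈ initConfig π r → p ≤ 0ℤ → 1 ℕ.≤ l
        labels≥1 m _ with initial-chips m
        ... | inj₁ refl              = ℕP.≤-trans (s≤s z≤n) 2≤r
        ... | inj₂ (j , _ , refl) = ℕP.≤-trans (s≤s z≤n) (v≤relabel r (val π j))
        one-near : ∃[ p ] p ≤ 0ℤ × (p , 1) ∈ initConfig π r
        one-near =
          let j , val≡1 = val-onto π (ℕ.>-nonZero⁻¹ n)
          in site j , site≤0 (ℕ.s≤s⁻¹ (one-left j val≡1)) ,
             subst (λ l → (site j , l) ∈ initConfig π r) (trans (cong (relabel r) val≡1) (relabel-< 2≤r))
                   (chip∈initial j)

    -- If 1 started right of the origin, every chip left of it would carry a label ≥ 2, and so would
    -- the first chip of the final configuration.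
    Toppleable⇒pos[1]≤origin : 2 ℕ.≤ r → r ℕ.≤ suc n → Toppleable π →
                               ∀ j → val π j ≡ 1 → pos j ℕ.≤ suc offset
    Toppleable⇒pos[1]≤origin 2≤r r≤n+1 toppleable j val≡1 with pos j ℕ.≤? suc offset
    ... | yes 1-left = 1-left
    ... | no 1-not-left =
      let _ , run , d-stable , reads = toppleable r (ℕP.≤-trans (s≤s z≤n) 2≤r) r≤n+1
          _ , just1≡just-l , 2≤l , _ = head-label 2 ⊥ line-OnePerSite lo≤0 0≤hi labels≥2 (λ ())
                                                  run d-stable reads
      in ⊥-elim (ℕP.<⇒≱ 2≤l (ℕP.≤-reflexive (sym (just-injective just1≡just-l))))
      where
        labels≥2 : ∀ {p l} → (p , l) ∈ initConfig π r → p ≤ 0ℤ → 2 ℕ.≤ l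
        labels≥2 m p≤0 with initial-chips m
        ... | inj₁ refl                 = 2≤r
        ... | inj₂ (j′ , refl , refl) = ℕP.≤-trans (s≤s (ℕP.n≢0⇒n>0 val≢1)) (v≤relabel r (val π j′))
          where
            val≢1 : toℕ (π ⟨$⟩ʳ j′) ≢ 0
            val≢1 eq = 1-not-left (subst (λ i → pos i ℕ.≤ suc offset)
                                    (val-injective π (trans (cong suc eq) (sym val≡1))) (s≤s (site≤0⁻¹ p≤0)))

    Topples⇒last≡n+1 : r ℕ.≤ n → (∀ j → val π j ≡ n → suc offset ℕ.≤ pos j) →
                       ∀ w → Topples π r w → last w ≡ just (n ℕ.+ 1)
    Topples⇒last≡n+1 r≤n n-right w (_ , run , d-stable , reads) =
      trans (last-label (suc n) line-OnePerSite lo≤0 0≤hi bound (0≤site (ℕ.s≤s⁻¹ (n-right j val≡n)))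
                        chip-n run d-stable reads)
            (cong just (ℕP.+-comm 1 n))
      where
        j-val : ∃[ j ] val π j ≡ n
        j-val = let j , val≡ = val-onto π (ℕP.m≤pred[n]⇒suc[m]≤n ℕP.≤-refl)
                in j , trans val≡ (ℕP.suc-pred n)
        j = proj₁ j-val
        val≡n = proj₂ j-val
        chip-n : (site j , suc n) ∈ initConfig π r
        chip-n = subst (λ l → (site j , l) ∈ initConfig π r)
                       (trans (cong (relabel r) val≡n) (relabel-≥ r≤n)) (chip∈initial j)
        bound : LabelsAtMost (suc n) (initConfig π r)
        bound m with initial-chips m
        ... | inj₁ refl              = ℕP.m≤n⇒m≤1+n r≤n
        ... | inj₂ (j , _ , refl) = ℕP.≤-trans (relabel≤suc r (val π j)) (s≤s (val≤n π j))

open Toppling using (module Seeded)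

open import Data.Nat using (ℕ; zero; suc; _+_; _*_; _∸_; _≤_; z≤n; s≤s; NonZero)
import Data.Nat.Properties as ℕP
open import Data.Nat.DivMod using (_/_; /-congˡ; m*n/n≡m; +-distrib-/-∣ˡ)
open import Data.Nat.Divisibility using (divides)
open import Data.Fin using (Fin)
open import Data.Fin.Permutation using (Permutation′)
open import Data.List using (List; head; last)
open import Data.Maybe using (just)
open import Data.Product using (_×_; _,_)
open import Relation.Binary.PropositionalEquality using (_≡_; refl; trans; cong; module ≡-Reasoning)

[2m]/2≡m : ∀ m → 2 * m / 2 ≡ m
[2m]/2≡m m = trans (/-congˡ (ℕP.*-comm 2 m)) (m*n/n≡m m 2)

[2m+1]/2≡m : ∀ m → (2 * m + 1) / 2 ≡ m
[2m+1]/2≡m m = begin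
  (2 * m + 1) / 2   ≡⟨ +-distrib-/-∣ˡ 1 (divides m (ℕP.*-comm 2 m)) ⟩
  2 * m / 2 + 0     ≡⟨ ℕP.+-identityʳ _ ⟩
  2 * m / 2         ≡⟨ [2m]/2≡m m ⟩
  m                 ∎
  where open ≡-Reasoning

origin-odd : ∀ m → suc ((2 * m + 1 ∸ 1) / 2) ≡ m + 1
origin-odd m = trans (cong (λ x → suc (x / 2)) (ℕP.m+n∸n≡m (2 * m) 1))
                     (trans (cong suc ([2m]/2≡m m)) (ℕP.+-comm 1 m))

-- 2 * suc k ∸ 1 computes to k + suc (k + 0).
origin-even : ∀ k → suc ((2 * suc k ∸ 1) / 2) ≡ suc k
origin-even k = trans (cong (λ x → suc (x / 2)) (trans (ℕP.+-suc k (k + 0)) (ℕP.+-comm 1 (2 * k))))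
                      (cong suc ([2m+1]/2≡m k))

-- o is the position in π of the chip that starts at the origin.
first-and-last-chips : ∀ {n} .{{_ : NonZero n}} {o} r → suc ((n ∸ 1) / 2) ≡ o → 2 ≤ r → r ≤ n →
  ((π : Permutation′ n) → Toppleable π → ∀ (j : Fin n) → val π j ≡ 1 → pos j ≤ o)
  × ((π : Permutation′ n) → (∀ (j : Fin n) → val π j ≡ 1 → pos j ≤ o) →
     ∀ (w : List ℕ) → Topples π r w → head w ≡ just 1)
  × ((π : Permutation′ n) → (∀ (j : Fin n) → val π j ≡ n → o ≤ pos j) →
     ∀ (w : List ℕ) → Topples π r w → last w ≡ just (n + 1))
first-and-last-chips r refl 2≤r r≤n =
    (λ π → Seeded.Toppleable⇒pos[1]≤origin π r 2≤r (ℕP.m≤n⇒m≤1+n r≤n))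
  , (λ π → Seeded.Topples⇒head≡1 π r 2≤r)
  , (λ π → Seeded.Topples⇒last≡n+1 π r r≤n)

lemma3p3 : (m : ℕ) → 1 ≤ m →
    ((π : Permutation′ (2 * m + 1)) → Toppleable π →
       ∀ (j : Fin (2 * m + 1)) → val π j ≡ 1 → pos j ≤ m + 1)
    × ((π : Permutation′ (2 * m + 1)) →
       (∀ (j : Fin (2 * m + 1)) → val π j ≡ 1 → pos j ≤ m + 1) →
       ∀ (w : List ℕ) → Topples π (m + 1) w → head w ≡ just 1)
    × ((π : Permutation′ (2 * m + 1)) →
       (∀ (j : Fin (2 * m + 1)) → val π j ≡ 2 * m + 1 → m + 1 ≤ pos j) →
       ∀ (w : List ℕ) → Topples π (m + 1) w → last w ≡ just (2 * m + 1 + 1))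
    × ((π : Permutation′ (2 * m)) → Toppleable π →
       ∀ (j : Fin (2 * m)) → val π j ≡ 1 → pos j ≤ m)
    × ((π : Permutation′ (2 * m)) →
       (∀ (j : Fin (2 * m)) → val π j ≡ 1 → pos j ≤ m) →
       ∀ (w : List ℕ) → Topples π (m + 1) w → head w ≡ just 1)
    × ((π : Permutation′ (2 * m)) →
       (∀ (j : Fin (2 * m)) → val π j ≡ 2 * m → m ≤ pos j) →
       ∀ (w : List ℕ) → Topples π (m + 1) w → last w ≡ just (2 * m + 1))
lemma3p3 zero ()
lemma3p3 (suc k) _ =
  let odd₁ , odd₂ , odd₃    = first-and-last-chips (suc k + 1) (origin-odd (suc k)) 2≤r
                                                   (ℕP.m≤n⇒m≤n+o 1 r≤2m)
      even₁ , even₂ , even₃ = first-and-last-chips (suc k + 1) (origin-even k) 2≤r r≤2m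
  in odd₁ , odd₂ , odd₃ , even₁ , even₂ , even₃
  where
    2≤r : 2 ≤ suc k + 1
    2≤r = s≤s (ℕP.m≤n+m 1 k)
    r≤2m : suc k + 1 ≤ 2 * suc k
    r≤2m = ℕP.+-monoʳ-≤ (suc k) (s≤s z≤n)
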